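{- Let $G$ be a finite simple graph on $n\geq 1$ vertices and let $\bar{\zeta}=\frac{1}{n}\sum_{v\in V(G)}\zeta(v)$. Then $$\alpha(G)\geq \frac{n}{\bar{\zeta}+1}.$$
   Context: $\alpha(G)$ is the independence number of $G$. For a vertex $v$, $\zeta(v)=\max_H \delta(H)$, the maximum over all subgraphs $H$ of $G$ containing $v$, where $\delta(H)$ is the minimum degree of $H$. -}

module Defs where

open import Data.Nat using (ℕ; _≤_)
open import Data.Bool using (Bool; true; false)
open import Data.Fin using (Fin)
open import Data.Fin.Subset using (Subset; _∈_; ∣_∣)
open import Data.Vec using (tabulate)
open import Data.List using (map; allFin)
open import Data.Nat.ListAction using (sum)
open import Data.Product using (Σ; ∃; _×_)
open import Relation.Binary.PropositionalEquality using (_≡_)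

record Graph (n : ℕ) : Set where
  field
    adj    : Fin n → Fin n → Bool
    sym    : ∀ u w → adj u w ≡ adj w u
    irrefl : ∀ u → adj u u ≡ false
open Graph public

record Subgraph {n : ℕ} (G : Graph n) : Set where
  field
    verts  : Subset n
    edges  : Fin n → Fin n → Bool
    e-sym  : ∀ u w → edges u w ≡ edges w u
    e-sub  : ∀ u w → edges u w ≡ true → adj G u w ≡ true
    e-inˡ  : ∀ u w → edges u w ≡ true → u ∈ verts
    e-inʳ  : ∀ u w → edges u w ≡ true → w ∈ verts
open Subgraph public

deg : ∀ {n} {G : Graph n} → Subgraph G → Fin n → ℕ
deg H u = ∣ tabulate (edges H u) ∣

IsMinDegree : ∀ {n} {G : Graph n} → Subgraph G → ℕ → Set
IsMinDegree {n} H d =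
  (Σ (Fin n) λ u → u ∈ verts H × deg H u ≡ d) ×
  (∀ u → u ∈ verts H → d ≤ deg H u)

IsZeta : ∀ {n} → Graph n → Fin n → ℕ → Set
IsZeta G v k =
  (Σ (Subgraph G) λ H → v ∈ verts H × IsMinDegree H k) ×
  (∀ (H : Subgraph G) (d : ℕ) → v ∈ verts H → IsMinDegree H d → d ≤ k)

Independent : ∀ {n} → Graph n → Subset n → Set
Independent G S = ∀ u w → u ∈ S → w ∈ S → adj G u w ≡ false

IsIndependenceNumber : ∀ {n} → Graph n → ℕ → Set
IsIndependenceNumber {n} G a =
  (Σ (Subset n) λ S → Independent G S × ∣ S ∣ ≡ a) ×
  (∀ S → Independent G S → ∣ S ∣ ≤ a)

sumFin : ∀ {n} → (Fin n → ℕ) → ℕ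
sumFin {n} f = sum (map f (allFin n))

-- Greedy argument.  Let v have minimum degree d in the induced subgraph G[W].
-- As G[W] contains every i ∈ W, d ≤ ζ(i) for all i ∈ W; hence the closed
-- neighbourhood N of v in G[W] satisfies |N| ≤ d + 1 ≤ ζ(i) + 1 for i ∈ N, that
-- is |N|² ≤ Σ_{i∈N} (ζ(i) + 1).  Put v into the independent set and recurse on
-- W ∖ N.  The fraction-free invariant |W|² ≤ |I| · Σ_{i∈W} (ζ(i) + 1) survives
-- each step by the two-term Cauchy–Schwarz inequality, and for W = V(G) it is
-- the theorem.
module Submission where

open import Defs hiding (sym)
open import Data.Bool using (Bool; true; false; _∧_; _∨_; not; if_then_else_)
open import Data.Bool.Properties using (∧-comm)
import Data.Bool as Bool
open import Data.Fin using (Fin; zero; suc; _≟_)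
open import Data.Fin.Properties using (any?)
open import Data.Fin.Subset using (_∈_; ∣_∣)
open import Data.List using (_∷_; [])
import Data.List as List using (tabulate)
open import Data.List.Properties using (map-tabulate)
open import Data.Nat.ListAction using (sum)
open import Data.Nat using (ℕ; zero; suc; _+_; _*_; _≤_; _<_; z≤n; s≤s; _≤?_; _<?_)
open import Data.Nat.Induction using (<-wellFounded)
open import Data.Nat.Properties hiding (_≟_)
open import Data.Nat.Tactic.RingSolver using (solve)
open import Data.Product using (∃-syntax; _×_; _,_; proj₁; proj₂)
open import Data.Sum using (_⊎_; inj₁; inj₂)
open import Data.Vec using (tabulate)
open import Data.Vec.Properties using (lookup∘tabulate; []=⇒lookup; lookup⇒[]=)
open import Function using (_∘_; _on_)
open import Induction.WellFounded using (Acc; acc)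
import Relation.Binary.Construct.On as On
open import Relation.Binary.PropositionalEquality
open import Relation.Nullary using (yes; no; does; contradiction; _×-dec_)

open import Algebra.Properties.Semiring.Sum +-*-semiring
  using (sum-syntax; sum-cong-≗; ∑-distrib-+; *-distribʳ-sum; sum-replicate-zero)

m*m≤n*n⇒m≤n : ∀ {m n} → m * m ≤ n * n → m ≤ n
m*m≤n*n⇒m≤n {m} {n} m²≤n² with m ≤? n
... | yes m≤n = m≤n
... | no  m≰n = contradiction m²≤n² (<⇒≱ (*-mono-< (≰⇒> m≰n) (≰⇒> m≰n)))

4xy≤[x+y]²-ordered : ∀ {x y} → x ≤ y → 4 * (x * y) ≤ (x + y) * (x + y)
4xy≤[x+y]²-ordered {x} x≤y with m≤n⇒∃[o]m+o≡n x≤y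
... | t , refl = begin
  4 * (x * (x + t))               ≤⟨ m≤m+n _ (t * t) ⟩
  4 * (x * (x + t)) + t * t       ≡⟨ solve (x ∷ t ∷ []) ⟩
  (x + (x + t)) * (x + (x + t))   ∎
  where open ≤-Reasoning

4xy≤[x+y]² : ∀ x y → 4 * (x * y) ≤ (x + y) * (x + y)
4xy≤[x+y]² x y with ≤-total x y
... | inj₁ x≤y = 4xy≤[x+y]²-ordered x≤y
... | inj₂ y≤x = subst₂ _≤_ (cong (4 *_) (*-comm y x)) (cong (λ s → s * s) (+-comm y x))
                   (4xy≤[x+y]²-ordered y≤x)

am-gm : ∀ x y z → z * z ≤ x * y → 2 * z ≤ x + y
am-gm x y z z²≤xy = m*m≤n*n⇒m≤n (begin
  2 * z * (2 * z) ≡⟨ solve (z ∷ []) ⟩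
  4 * (z * z)     ≤⟨ *-monoʳ-≤ 4 z²≤xy ⟩
  4 * (x * y)     ≤⟨ 4xy≤[x+y]² x y ⟩
  (x + y) * (x + y) ∎)
  where open ≤-Reasoning

cauchy-schwarz₂ : ∀ a b x y s t → a * a ≤ x * s → b * b ≤ y * t →
                  (a + b) * (a + b) ≤ (x + y) * (s + t)
cauchy-schwarz₂ a b x y s t a²≤xs b²≤yt = begin
  (a + b) * (a + b)                 ≡⟨ solve (a ∷ b ∷ []) ⟩
  a * a + 2 * (a * b) + b * b       ≤⟨ +-mono-≤ (+-mono-≤ a²≤xs (am-gm (x * t) (y * s) (a * b) cross)) b²≤yt ⟩
  x * s + (x * t + y * s) + y * t   ≡⟨ solve (x ∷ y ∷ s ∷ t ∷ []) ⟩
  (x + y) * (s + t)                 ∎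
  where
  open ≤-Reasoning
  cross : a * b * (a * b) ≤ x * t * (y * s)
  cross = begin
    a * b * (a * b)   ≡⟨ solve (a ∷ b ∷ []) ⟩
    a * a * (b * b)   ≤⟨ *-mono-≤ a²≤xs b²≤yt ⟩
    x * s * (y * t)   ≡⟨ solve (x ∷ y ∷ s ∷ t ∷ []) ⟩
    x * t * (y * s)   ∎

∑-mono-≤ : ∀ {n} {f g : Fin n → ℕ} → (∀ i → f i ≤ g i) → ∑[ i < n ] f i ≤ ∑[ i < n ] g i
∑-mono-≤ {zero}  f≤g = z≤n
∑-mono-≤ {suc n} f≤g = +-mono-≤ (f≤g zero) (∑-mono-≤ (f≤g ∘ suc))

∑-const-1 : ∀ n → ∑[ i < n ] 1 ≡ n
∑-const-1 zero    = refl
∑-const-1 (suc n) = cong suc (∑-const-1 n)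

∑-suc : ∀ {n} (f : Fin n → ℕ) → ∑[ i < n ] suc (f i) ≡ ∑[ i < n ] f i + n
∑-suc {n} f = begin
  ∑[ i < n ] suc (f i)              ≡⟨ sum-cong-≗ (λ i → +-comm 1 (f i)) ⟩
  ∑[ i < n ] (f i + 1)              ≡⟨ ∑-distrib-+ f (λ _ → 1) ⟩
  ∑[ i < n ] f i + ∑[ i < n ] 1     ≡⟨ cong (∑[ i < n ] f i +_) (∑-const-1 n) ⟩
  ∑[ i < n ] f i + n                ∎
  where open ≡-Reasoning

sumFin≡∑ : ∀ {n} (f : Fin n → ℕ) → sumFin f ≡ ∑[ i < n ] f i
sumFin≡∑ {n} f = trans (cong sum (map-tabulate (λ i → i) f)) (sum-tabulate f)
  where
  sum-tabulate : ∀ {n} (g : Fin n → ℕ) → sum (List.tabulate g) ≡ ∑[ i < n ] g i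
  sum-tabulate {zero}  g = refl
  sum-tabulate {suc n} g = cong (g zero +_) (sum-tabulate (g ∘ suc))

∧-elimˡ : ∀ a {b} → a ∧ b ≡ true → a ≡ true
∧-elimˡ true _ = refl

∧-elimʳ : ∀ a {b} → a ∧ b ≡ true → b ≡ true
∧-elimʳ true a∧b = a∧b

∨-elim : ∀ a {b} → a ∨ b ≡ true → a ≡ true ⊎ b ≡ true
∨-elim true  _   = inj₁ refl
∨-elim false a∨b = inj₂ a∨b

∧-∨-not-elim : ∀ a b c → (a ∧ (b ∨ c)) ∧ not b ≡ true → c ∧ a ≡ true
∧-∨-not-elim true false true  _ = refl
∧-∨-not-elim true false false ()
∧-∨-not-elim true true  c     ()
∧-∨-not-elim false b    c     ()

∧-not-∨-elim : ∀ a b c → a ∧ not (b ∨ c) ≡ true → a ≡ true × b ≡ false × c ≡ false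
∧-not-∨-elim true false false _ = refl , refl , refl
∧-not-∨-elim true false true  ()
∧-not-∨-elim true true  c     ()
∧-not-∨-elim false b    c     ()

_⊆ᵇ_ : ∀ {n} → (Fin n → Bool) → (Fin n → Bool) → Set
P ⊆ᵇ Q = ∀ i → P i ≡ true → Q i ≡ true

_∩ᵇ_ _─ᵇ_ _∪ᵇ_ : ∀ {n} → (Fin n → Bool) → (Fin n → Bool) → (Fin n → Bool)
(P ∩ᵇ Q) i = P i ∧ Q i
(P ─ᵇ Q) i = P i ∧ not (Q i)
(P ∪ᵇ Q) i = P i ∨ Q i

⊥ᵇ ⊤ᵇ : ∀ {n} → Fin n → Bool
⊥ᵇ _ = false
⊤ᵇ _ = true

-- With ⌊ v ≟ i ⌋ instead of does, ⁅ suc v ⁆ᵇ ∘ suc would not reduce to ⁅ v ⁆ᵇ.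
⁅_⁆ᵇ : ∀ {n} → Fin n → (Fin n → Bool)
⁅ v ⁆ᵇ i = does (v ≟ i)

restrict : ∀ {n} → (Fin n → ℕ) → (Fin n → Bool) → (Fin n → ℕ)
restrict w P i = if P i then w i else 0

weight : ∀ {n} → (Fin n → ℕ) → (Fin n → Bool) → ℕ
weight {n} w P = ∑[ i < n ] restrict w P i

card : ∀ {n} → (Fin n → Bool) → ℕ
card = weight (λ _ → 1)

weight-split : ∀ {n} (w : Fin n → ℕ) P Q → weight w P ≡ weight w (P ∩ᵇ Q) + weight w (P ─ᵇ Q)
weight-split w P Q = trans (sum-cong-≗ λ i → split (P i) (Q i) (w i))
                           (∑-distrib-+ (restrict w (P ∩ᵇ Q)) (restrict w (P ─ᵇ Q)))
  where
  split : ∀ a b x → (if a then x else 0) ≡ (if a ∧ b then x else 0) + (if a ∧ not b then x else 0)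
  split true  true  x = sym (+-identityʳ x)
  split true  false x = refl
  split false b     x = refl

weight-mono-⊆ : ∀ {n} (w : Fin n → ℕ) {P Q} → P ⊆ᵇ Q → weight w P ≤ weight w Q
weight-mono-⊆ w {P} {Q} P⊆Q = ∑-mono-≤ λ i → mono (P i) (Q i) (w i) (P⊆Q i)
  where
  mono : ∀ a b x → (a ≡ true → b ≡ true) → (if a then x else 0) ≤ (if b then x else 0)
  mono true  b x a⇒b rewrite a⇒b refl = ≤-refl
  mono false b x a⇒b = z≤n

weight-∪-disjoint : ∀ {n} (w : Fin n → ℕ) P Q → (∀ i → P i ≡ true → Q i ≡ false) →
                    weight w (P ∪ᵇ Q) ≡ weight w P + weight w Q
weight-∪-disjoint w P Q disjoint = trans (sum-cong-≗ λ i → union (P i) (Q i) (w i) (disjoint i))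
                                         (∑-distrib-+ (restrict w P) (restrict w Q))
  where
  union : ∀ a b x → (a ≡ true → b ≡ false) →
          (if a ∨ b then x else 0) ≡ (if a then x else 0) + (if b then x else 0)
  union true  b x a⇒¬b rewrite a⇒¬b refl = sym (+-identityʳ x)
  union false b x a⇒¬b = refl

card*≤weight : ∀ {n} (w : Fin n → ℕ) P m → (∀ i → P i ≡ true → m ≤ w i) → card P * m ≤ weight w P
card*≤weight w P m m≤w = ≤-trans (≤-reflexive (*-distribʳ-sum m (restrict (λ _ → 1) P)))
                                 (∑-mono-≤ λ i → bound (P i) (w i) (m≤w i))
  where
  bound : ∀ a x → (a ≡ true → m ≤ x) → (if a then 1 else 0) * m ≤ (if a then x else 0)
  bound true  x m≤x = ≤-trans (≤-reflexive (*-identityˡ m)) (m≤x refl)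
  bound false x m≤x = z≤n

card-⁅⁆ : ∀ {n} (v : Fin n) → card ⁅ v ⁆ᵇ ≡ 1
card-⁅⁆ {suc n} zero    = cong suc (sum-replicate-zero n)
card-⁅⁆ {suc n} (suc v) = card-⁅⁆ v

∈⁅⁆⇒≡ : ∀ {n} {v i : Fin n} → ⁅ v ⁆ᵇ i ≡ true → v ≡ i
∈⁅⁆⇒≡ {v = v} {i} with v ≟ i
... | yes v≡i = λ _ → v≡i
... | no  _   = λ ()

card-tabulate : ∀ {n} (P : Fin n → Bool) → ∣ tabulate P ∣ ≡ card P
card-tabulate {zero}  P = refl
card-tabulate {suc n} P with P zero
... | true  = cong suc (card-tabulate (P ∘ suc))
... | false = card-tabulate (P ∘ suc)

∈-tabulate⁺ : ∀ {n} {P : Fin n → Bool} {i} → P i ≡ true → i ∈ tabulate P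
∈-tabulate⁺ {P = P} {i} Pi = lookup⇒[]= i (tabulate P) (trans (lookup∘tabulate P i) Pi)

∈-tabulate⁻ : ∀ {n} {P : Fin n → Bool} {i} → i ∈ tabulate P → P i ≡ true
∈-tabulate⁻ {P = P} {i} i∈P = trans (sym (lookup∘tabulate P i)) ([]=⇒lookup i∈P)

∃-minimum : ∀ {n} (P : Fin n → Bool) (g : Fin n → ℕ) {v} → P v ≡ true →
            ∃[ u ] P u ≡ true × (∀ i → P i ≡ true → g u ≤ g i)
∃-minimum P g {v} Pv = descend v Pv (<-wellFounded (g v))
  where
  descend : ∀ v → P v ≡ true → Acc _<_ (g v) → ∃[ u ] P u ≡ true × (∀ i → P i ≡ true → g u ≤ g i)
  descend v Pv (acc smaller) with any? (λ i → (P i Bool.≟ true) ×-dec (g i <? g v))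
  ... | yes (u , Pu , gu<gv) = descend u Pu (smaller gu<gv)
  ... | no  ∄smaller         = v , Pv , λ i Pi → ≮⇒≥ λ gi<gv → ∄smaller (i , Pi , gi<gv)

module _ {n} (G : Graph n) where

  induced : (Fin n → Bool) → Subgraph G
  induced W = record
    { verts = tabulate W
    ; edges = λ u x → adj G u x ∧ (W u ∧ W x)
    ; e-sym = λ u x → cong₂ _∧_ (Graph.sym G u x) (∧-comm (W u) (W x))
    ; e-sub = λ u x e → ∧-elimˡ (adj G u x) e
    ; e-inˡ = λ u x e → ∈-tabulate⁺ (∧-elimˡ (W u) (∧-elimʳ (adj G u x) e))
    ; e-inʳ = λ u x e → ∈-tabulate⁺ (∧-elimʳ (W u) (∧-elimʳ (adj G u x) e))
    }

  closedNbhd : Fin n → (Fin n → Bool)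
  closedNbhd v = ⁅ v ⁆ᵇ ∪ᵇ adj G v

  Independentᵇ : (Fin n → Bool) → Set
  Independentᵇ I = ∀ u w → I u ≡ true → I w ≡ true → adj G u w ≡ false

  independent-tabulate : ∀ {I} → Independentᵇ I → Independent G (tabulate I)
  independent-tabulate indep u w u∈I w∈I = indep u w (∈-tabulate⁻ u∈I) (∈-tabulate⁻ w∈I)

  MinDegreeBound : (Fin n → ℕ) → Set
  MinDegreeBound ζ = ∀ W i d → W i ≡ true → IsMinDegree (induced W) d → d ≤ ζ i

  isZeta⇒minDegreeBound : ∀ {ζ} → (∀ v → IsZeta G v (ζ v)) → MinDegreeBound ζ
  isZeta⇒minDegreeBound isZeta W i d Wi = proj₂ (isZeta i) (induced W) d (∈-tabulate⁺ Wi)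

  LargeIndependentSubset : (Fin n → ℕ) → (Fin n → Bool) → Set
  LargeIndependentSubset ζ W =
    ∃[ I ] I ⊆ᵇ W × Independentᵇ I × card W * card W ≤ card I * weight (suc ∘ ζ) W

  module _ {W : Fin n → Bool} {v : Fin n} (v∈W : W v ≡ true) where

    private
      N = W ∩ᵇ closedNbhd v

    ⁅v⁆⊆closedNbhd : ⁅ v ⁆ᵇ ⊆ᵇ N
    ⁅v⁆⊆closedNbhd i v≟i with refl ← ∈⁅⁆⇒≡ {v = v} {i} v≟i rewrite v∈W | v≟i = refl

    card-remove-closedNbhd< : card (W ─ᵇ closedNbhd v) < card W
    card-remove-closedNbhd< = begin-strict
      card (W ─ᵇ closedNbhd v)            <⟨ m<n+m _ (≤-trans (≤-reflexive (sym (card-⁅⁆ v)))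
                                                            (weight-mono-⊆ _ ⁅v⁆⊆closedNbhd)) ⟩
      card N + card (W ─ᵇ closedNbhd v)   ≡⟨ weight-split _ W (closedNbhd v) ⟨
      card W                              ∎
      where open ≤-Reasoning

    card-closedNbhd≤1+deg : card N ≤ suc (deg (induced W) v)
    card-closedNbhd≤1+deg = begin
      card N                                       ≡⟨ weight-split _ N ⁅ v ⁆ᵇ ⟩
      card (N ∩ᵇ ⁅ v ⁆ᵇ) + card (N ─ᵇ ⁅ v ⁆ᵇ)      ≤⟨ +-mono-≤ (weight-mono-⊆ _ λ i → ∧-elimʳ (N i))
                                                               (weight-mono-⊆ _ N─v⊆edges) ⟩
      card ⁅ v ⁆ᵇ + card (edges (induced W) v)     ≡⟨ cong₂ _+_ (card-⁅⁆ v)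
                                                               (sym (card-tabulate (edges (induced W) v))) ⟩
      suc (deg (induced W) v)                      ∎
      where
      open ≤-Reasoning
      N─v⊆edges : (N ─ᵇ ⁅ v ⁆ᵇ) ⊆ᵇ edges (induced W) v
      N─v⊆edges i e rewrite v∈W = ∧-∨-not-elim (W i) (⁅ v ⁆ᵇ i) (adj G v i) e

    card²≤weight-closedNbhd : ∀ {ζ} → MinDegreeBound ζ → IsMinDegree (induced W) (deg (induced W) v) →
                              card N * card N ≤ weight (suc ∘ ζ) N
    card²≤weight-closedNbhd {ζ} bound v-min = card*≤weight (suc ∘ ζ) N (card N) λ i Ni →
      ≤-trans card-closedNbhd≤1+deg (s≤s (bound W i _ (∧-elimˡ (W i) Ni) v-min))

    module _ {I : Fin n → Bool} (I⊆W─N : I ⊆ᵇ (W ─ᵇ closedNbhd v)) where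

      private
        outside : ∀ i → I i ≡ true → W i ≡ true × ⁅ v ⁆ᵇ i ≡ false × adj G v i ≡ false
        outside i Ii = ∧-not-∨-elim (W i) (⁅ v ⁆ᵇ i) (adj G v i) (I⊆W─N i Ii)

        member : ∀ x → (⁅ v ⁆ᵇ ∪ᵇ I) x ≡ true → v ≡ x ⊎ I x ≡ true
        member x e with ∨-elim (⁅ v ⁆ᵇ x) e
        ... | inj₁ v≟x = inj₁ (∈⁅⁆⇒≡ v≟x)
        ... | inj₂ Ix  = inj₂ Ix

      insert-⊆ : (⁅ v ⁆ᵇ ∪ᵇ I) ⊆ᵇ W
      insert-⊆ x e with member x e
      ... | inj₁ refl = v∈W
      ... | inj₂ Ix   = proj₁ (outside x Ix)

      insert-independent : Independentᵇ I → Independentᵇ (⁅ v ⁆ᵇ ∪ᵇ I)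
      insert-independent I-indep x y ex ey with member x ex | member y ey
      ... | inj₁ refl | inj₁ refl = irrefl G v
      ... | inj₁ refl | inj₂ Iy   = proj₂ (proj₂ (outside y Iy))
      ... | inj₂ Ix   | inj₁ refl = trans (Graph.sym G x v) (proj₂ (proj₂ (outside x Ix)))
      ... | inj₂ Ix   | inj₂ Iy   = I-indep x y Ix Iy

      card-insert : card (⁅ v ⁆ᵇ ∪ᵇ I) ≡ 1 + card I
      card-insert = trans (weight-∪-disjoint (λ _ → 1) ⁅ v ⁆ᵇ I v∉I) (cong (_+ card I) (card-⁅⁆ v))
        where
        v∉I : ∀ i → ⁅ v ⁆ᵇ i ≡ true → I i ≡ false
        v∉I i v≟i with I i in Ii
        ... | false = refl
        ... | true  = contradiction (trans (sym v≟i) (proj₁ (proj₂ (outside i Ii)))) λ ()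

    insert-minimum : ∀ {ζ} → MinDegreeBound ζ → IsMinDegree (induced W) (deg (induced W) v) →
                     LargeIndependentSubset ζ (W ─ᵇ closedNbhd v) → LargeIndependentSubset ζ W
    insert-minimum {ζ} bound v-min (I , I⊆W─N , I-indep , I-large) =
      ⁅ v ⁆ᵇ ∪ᵇ I , insert-⊆ I⊆W─N , insert-independent I⊆W─N I-indep , v∪I-large
      where
      W─N = W ─ᵇ closedNbhd v
      v∪I-large : card W * card W ≤ card (⁅ v ⁆ᵇ ∪ᵇ I) * weight (suc ∘ ζ) W
      v∪I-large = begin
        card W * card W
          ≡⟨ cong (λ m → m * m) (weight-split (λ _ → 1) W (closedNbhd v)) ⟩
        (card N + card W─N) * (card N + card W─N)
          ≤⟨ cauchy-schwarz₂ (card N) (card W─N) 1 (card I) (weight (suc ∘ ζ) N) (weight (suc ∘ ζ) W─N)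
               (≤-trans (card²≤weight-closedNbhd bound v-min) (≤-reflexive (sym (*-identityˡ _))))
               I-large ⟩
        (1 + card I) * (weight (suc ∘ ζ) N + weight (suc ∘ ζ) W─N)
          ≡⟨ cong₂ _*_ (card-insert I⊆W─N) (weight-split (suc ∘ ζ) W (closedNbhd v)) ⟨
        card (⁅ v ⁆ᵇ ∪ᵇ I) * weight (suc ∘ ζ) W
          ∎
        where open ≤-Reasoning

  greedy : ∀ {ζ} → MinDegreeBound ζ → ∀ W → LargeIndependentSubset ζ W
  greedy {ζ} bound W = go W (On.wellFounded card <-wellFounded W)
    where
    go : ∀ W → Acc (_<_ on card) W → LargeIndependentSubset ζ W
    go W (acc smaller) with any? (λ i → W i Bool.≟ true)
    ... | no ∄i = ⊥ᵇ , (λ _ ()) , (λ _ _ ()) , W²≤0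
      where
      W≤0 : card W ≤ 0
      W≤0 = ≤-trans (weight-mono-⊆ (λ _ → 1) λ i Wi → contradiction (i , Wi) ∄i)
                    (≤-reflexive (sum-replicate-zero n))
      W²≤0 : card W * card W ≤ card (⊥ᵇ {n}) * weight (suc ∘ ζ) W
      W²≤0 = subst (λ m → m * m ≤ card (⊥ᵇ {n}) * weight (suc ∘ ζ) W) (sym (n≤0⇒n≡0 W≤0)) z≤n
    ... | yes (i , Wi) with ∃-minimum W (deg (induced W)) Wi
    ...   | v , v∈W , v-min =
      insert-minimum v∈W bound ((v , ∈-tabulate⁺ v∈W , refl) , λ u u∈W → v-min u (∈-tabulate⁻ u∈W))
        (go (W ─ᵇ closedNbhd v) (smaller (card-remove-closedNbhd< v∈W)))

-- The hypothesis n ≥ 1 only serves to make the fraction n / (ζ̄ + 1) meaningful.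
proposition4 : ∀ {n : ℕ} → 1 ≤ n → (G : Graph n) →
    (ζ : Fin n → ℕ) → (∀ v → IsZeta G v (ζ v)) →
    (α : ℕ) → IsIndependenceNumber G α →
    n * n ≤ α * (sumFin ζ + n)
proposition4 {n} _ G ζ isZeta α (_ , maximum)
  with greedy G (isZeta⇒minDegreeBound G isZeta) ⊤ᵇ
... | I , _ , I-indep , V²≤IV = begin
  n * n                            ≡⟨ cong (λ m → m * m) (∑-const-1 n) ⟨
  card V * card V                  ≤⟨ V²≤IV ⟩
  card I * weight (suc ∘ ζ) V      ≡⟨ cong₂ _*_ (sym (card-tabulate I)) weight-V ⟩
  ∣ tabulate I ∣ * (sumFin ζ + n)  ≤⟨ *-monoˡ-≤ _ (maximum _ (independent-tabulate G I-indep)) ⟩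
  α * (sumFin ζ + n)               ∎
  where
  open ≤-Reasoning
  V : Fin n → Bool
  V = ⊤ᵇ
  weight-V : weight (suc ∘ ζ) V ≡ sumFin ζ + n
  weight-V = trans (∑-suc ζ) (cong (_+ n) (sym (sumFin≡∑ ζ)))
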